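{- Let $m\in\mathcal{M}_{N,f}$ and let $T=T(m)$. Then $\mathrm{Des}(T)=\mathrm{Short}(m)$.
   Context: A matching on a finite set $S\subseteq\mathbb{N}$ is a partition of $S$ into blocks of size 1 (unmatched vertices) or 2 (chords $(i,j)$); $\mathcal{M}_{N,f}$ is the set of matchings on $[N]$ with exactly $f$ unmatched vertices. $\mathrm{Short}(m)=\{i\in[N-1]\mid (i,i+1)\text{ is a chord of }m\}$. The reduction process of $m$ repeatedly deletes a chord whose two endpoints are consecutive among the currently remaining vertices, until no such chord remains; deleted chords are unstable (this set does not depend on choices). If $m$ has $k$ unstable chords, $T(m)$ is the standard Young tableau with two rows whose second row is $\{ j \mid (i,j) \text{ is an unstable chord of } m,\ i<j\}$ and whose first row consists of the remaining elements of $[N]$; it has shape $(N-k,k)$. For a standard Young tableau $T$ (English notation), $\mathrm{Des}(T)=\{i\in[N-1]\mid i+1 \text{ lies in a lower row than } i\}$. -}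

module Defs where

open import Data.Nat using (ℕ; zero; suc; _<_; _≤_; _∸_; _≡ᵇ_)
open import Data.Nat.Properties using (_≟_)
open import Data.Fin using (Fin; toℕ)
open import Data.Bool using (Bool; true; false; if_then_else_; _∧_; not)
open import Data.List using (List; []; _∷_; length; filter; map)
open import Data.Bool.ListAction using (any)
open import Relation.Nullary.Decidable using (T?)
import Data.Bool as B
open import Data.List.Base using (allFin)
open import Data.Maybe using (Maybe; just; nothing)
open import Data.Product using (Σ; _×_; _,_; ∃)
open import Relation.Binary.PropositionalEquality using (_≡_)
open import Relation.Nullary.Decidable using (¬?)

-- Vertices are represented by Fin N, where
-- i : Fin N stands for the integer  lab i = toℕ i + 1.  A matching is an
-- involution: fixed points are the unmatched vertices, and the 2-cycles
-- {i, partner i} are the chords.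
record Matching (N : ℕ) : Set where
  field
    partner    : Fin N → Fin N
    involutive : ∀ i → partner (partner i) ≡ i
open Matching public

lab : {N : ℕ} → Fin N → ℕ
lab i = suc (toℕ i)

numUnmatched : {N : ℕ} → Matching N → ℕ
numUnmatched {N} m = length (filter (λ i → partner m i Data.Fin.≟ i) (allFin N))

InM : (N f : ℕ) → Matching N → Set
InM N f m = numUnmatched m ≡ f

IsChord : {N : ℕ} → Matching N → ℕ → ℕ → Set
IsChord {N} m a b = ∃ λ (i : Fin N) → lab i ≡ a × lab (partner m i) ≡ b × ¬ (a ≡ b)
  where open import Relation.Nullary using (¬_)

InShort : {N : ℕ} → Matching N → ℕ → Set
InShort {N} m i = 1 ≤ i × i ≤ N ∸ 1 × IsChord m i (suc i)

chordB : {N : ℕ} → Matching N → ℕ → ℕ → Bool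
chordB {N} m a b =
  not (a ≡ᵇ b) ∧ any (λ i → (lab i ≡ᵇ a) ∧ (lab (partner m i) ≡ᵇ b)) (allFin N)

-- One reduction step on the increasing list of remaining vertices: delete the
-- leftmost chord whose two endpoints are consecutive among the remaining
-- vertices; return its right endpoint and the remaining vertices.
step' : {N : ℕ} → Matching N → ℕ → List ℕ → Maybe (ℕ × List ℕ)
step' m a []         = nothing
step' m a (b ∷ rest) with chordB m a b
... | true  = just (b , rest)
... | false with step' m b rest
...   | nothing          = nothing
...   | just (c , rest') = just (c , a ∷ rest')

step : {N : ℕ} → Matching N → List ℕ → Maybe (ℕ × List ℕ)
step m []       = nothing
step m (a ∷ vs) = step' m a vs

-- Run the reduction process (fuel k) and collect the right endpoints of the
-- deleted (unstable) chords.
reduce : {N : ℕ} → Matching N → ℕ → List ℕ → List ℕ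
reduce m zero    vs = []
reduce m (suc k) vs with step m vs
... | nothing        = []
... | just (b , vs') = b ∷ reduce m k vs'

vertices : (N : ℕ) → List ℕ
vertices N = map lab (allFin N)

-- right endpoints j of unstable chords (i , j), i < j.  Each step deletes two
-- vertices, so fuel N suffices for the process to terminate.
unstableTops : {N : ℕ} → Matching N → List ℕ
unstableTops {N} m = reduce m N (vertices N)

memB : ℕ → List ℕ → Bool
memB x xs = any (x ≡ᵇ_) xs

-- A (two-row) tableau in English notation, given as its list of rows,
-- each row listed left to right.
Tableau : Set
Tableau = List (List ℕ)

T : {N : ℕ} → Matching N → Tableau
T {N} m = filter (λ v → T? (not (memB v (unstableTops m)))) (vertices N)
        ∷ filter (λ v → T? (memB v (unstableTops m))) (vertices N)
        ∷ []

-- the row (0 = top) containing entry v, if any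
rowOf : Tableau → ℕ → Maybe ℕ
rowOf [] v = nothing
rowOf (r ∷ rs) v = if memB v r then just 0 else Data.Maybe.map suc (rowOf rs v)

InDes : ℕ → Tableau → ℕ → Set
InDes N t i = 1 ≤ i × i ≤ N ∸ 1 ×
  (Σ ℕ λ r → Σ ℕ λ s → rowOf t i ≡ just r × rowOf t (suc i) ≡ just s × r < s)

-- Row 2 of T(m) holds the right endpoints of the unstable chords, so i+1 lies
-- below i exactly when i+1 is such an endpoint and i is not.  If (i, i+1) is a
-- chord, the two vertices stay adjacent until this chord is deleted, and i, a
-- left endpoint, is never a right endpoint.  Conversely, when the chord (c, i+1)
-- is deleted with i still present, adjacency forces c = i; and i cannot have
-- left earlier: as a right endpoint it would be in row 2, and as the left
-- endpoint of a chord (i, b) deleted while i+1 remains, adjacency would force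
-- b = i+1.

module Submission where

open import Defs
open import Data.Nat using (ℕ; zero; suc; _<_; _≤_; _∸_; _≡ᵇ_; z≤n; s≤s)
open import Data.Nat.Properties
  using ( ≡ᵇ⇒≡; ≡⇒≡ᵇ; _≟_; suc-injective; ≤-refl; ≤-reflexive; ≤-trans; ≤-antisym; ≤-pred
        ; <⇒≤; n≤1+n; n<1+n; <-irrefl; <-asym; ≤⇒≯; 1+n≰n)
open import Data.Fin as Fin using (Fin)
open import Data.Fin.Properties using (toℕ-injective; toℕ-fromℕ<)
open import Data.Bool using (Bool; true; false; not; _∧_; if_then_else_)
import Data.Bool as Bool
open import Data.Bool.Properties using (T-≡; T-not-≡; T-∧)
open import Data.Unit using (tt)
open import Data.Empty using (⊥-elim)
open import Data.List using (List; _∷_; length; filter; allFin)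
open import Data.List.Properties using (length-map; length-tabulate)
open import Data.List.Membership.Propositional using (_∈_; _∉_)
open import Data.List.Membership.Propositional.Properties using (∈-map⁺; ∈-filter⁺; ∈-filter⁻; ∈-allFin)
open import Data.List.Relation.Unary.Any as Any using (here; there)
open import Data.List.Relation.Unary.Any.Properties using (any⁺; any⁻)
open import Data.List.Relation.Unary.All as All using (_∷_)
open import Data.List.Relation.Unary.All.Properties using (anti-mono)
open import Data.List.Relation.Unary.AllPairs using (AllPairs; _∷_)
import Data.List.Relation.Unary.AllPairs.Properties as AllPairs
open import Data.Maybe using (just; nothing)
open import Data.Maybe.Properties using (just-injective)
open import Data.Product using (Σ; _×_; _,_; ∃; proj₂)
open import Data.Sum using (_⊎_; inj₁; inj₂)
open import Function using (_∘_)
open import Function.Bundles using (_⇔_; mk⇔; Equivalence)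
open import Function.Properties.Equivalence using () renaming (trans to ⇔-trans)
open import Relation.Binary.PropositionalEquality using (_≡_; refl; sym; trans; cong; subst; subst₂)
open import Relation.Nullary using (¬_; yes; no)
open import Relation.Nullary.Decidable using (T?)

open Equivalence using (to; from)

private
  variable
    a b c i x : ℕ
    L L' : List ℕ

T-not⇔¬T : ∀ {v} → Bool.T (not v) ⇔ (¬ Bool.T v)
T-not⇔¬T {false} = mk⇔ (λ _ ()) (λ _ → tt)
T-not⇔¬T {true}  = mk⇔ (λ ()) (λ ¬t → ¬t tt)

memB⇔∈ : ∀ {xs} → Bool.T (memB x xs) ⇔ x ∈ xs
memB⇔∈ {x} {xs} =
  mk⇔ (Any.map (λ {y} → ≡ᵇ⇒≡ x y) ∘ any⁻ (x ≡ᵇ_) xs)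
      (any⁺ (x ≡ᵇ_) ∘ Any.map (λ {y} → ≡⇒≡ᵇ x y))

memB-filter : ∀ (p : ℕ → Bool) {xs} → x ∈ xs → memB x (filter (λ v → T? (p v)) xs) ≡ p x
memB-filter {x} p {xs} x∈xs with p x in px
... | true  = to T-≡ (from memB⇔∈ (∈-filter⁺ (λ v → T? (p v)) x∈xs (from T-≡ px)))
... | false = to T-not-≡ (from T-not⇔¬T
  (subst Bool.T px ∘ proj₂ ∘ ∈-filter⁻ (λ v → T? (p v)) {xs = xs} ∘ to memB⇔∈))

Sorted : List ℕ → Set
Sorted = AllPairs _<_

data PairRemoved (c b : ℕ) : List ℕ → List ℕ → Set where
  here  : PairRemoved c b (c ∷ b ∷ L) L
  there : PairRemoved c b L L' → PairRemoved c b (x ∷ L) (x ∷ L')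

removed-∈ˡ : PairRemoved c b L L' → c ∈ L
removed-∈ˡ here      = here refl
removed-∈ˡ (there r) = there (removed-∈ˡ r)

removed-∈ʳ : PairRemoved c b L L' → b ∈ L
removed-∈ʳ here      = there (here refl)
removed-∈ʳ (there r) = there (removed-∈ʳ r)

removed-⊆ : PairRemoved c b L L' → x ∈ L' → x ∈ L
removed-⊆ here      x∈       = there (there x∈)
removed-⊆ (there r) (here p)  = here p
removed-⊆ (there r) (there x∈) = there (removed-⊆ r x∈)

removed-split : PairRemoved c b L L' → x ∈ L → x ≡ c ⊎ x ≡ b ⊎ x ∈ L'
removed-split here      (here p)          = inj₁ p
removed-split here      (there (here p))  = inj₂ (inj₁ p)
removed-split here      (there (there p)) = inj₂ (inj₂ p)
removed-split (there r) (here p)          = inj₂ (inj₂ (here p))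
removed-split (there r) (there x∈) with removed-split r x∈
... | inj₁ p          = inj₁ p
... | inj₂ (inj₁ p)   = inj₂ (inj₁ p)
... | inj₂ (inj₂ x∈') = inj₂ (inj₂ (there x∈'))

removed-keeps : PairRemoved c b L L' → x ∈ L → ¬ (x ≡ c ⊎ x ≡ b) → x ∈ L'
removed-keeps r x∈ x∉cb with removed-split r x∈
... | inj₁ p          = ⊥-elim (x∉cb (inj₁ p))
... | inj₂ (inj₁ p)   = ⊥-elim (x∉cb (inj₂ p))
... | inj₂ (inj₂ x∈') = x∈'

removed-length : PairRemoved c b L L' → length L ≡ suc (suc (length L'))
removed-length here      = refl
removed-length (there r) = cong suc (removed-length r)

removed-sorted : PairRemoved c b L L' → Sorted L → Sorted L'
removed-sorted here      (_ ∷ _ ∷ s)  = s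
removed-sorted (there r) (x<L ∷ s) = anti-mono (removed-⊆ r) x<L ∷ removed-sorted r s

removed-< : PairRemoved c b L L' → Sorted L → c < b
removed-< here      ((c<b ∷ _) ∷ _) = c<b
removed-< (there r) (_ ∷ s)         = removed-< r s

removed-gap : PairRemoved c b L L' → Sorted L → x ∈ L → x ≤ c ⊎ b ≤ x
removed-gap here      _               (here refl)          = inj₁ ≤-refl
removed-gap here      _               (there (here refl))  = inj₂ ≤-refl
removed-gap here      (_ ∷ b<L ∷ _)   (there (there x∈))   = inj₂ (<⇒≤ (All.lookup b<L x∈))
removed-gap (there r) (x<L ∷ _)       (here refl)          = inj₁ (<⇒≤ (All.lookup x<L (removed-∈ˡ r)))
removed-gap (there r) (_ ∷ s)         (there x∈)           = removed-gap r s x∈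

consecutive-removable : Sorted L → i ∈ L → suc i ∈ L → ∃ (PairRemoved i (suc i) L)
consecutive-removable _ (here refl) (here 1+i≡i) = ⊥-elim (<-irrefl (sym 1+i≡i) (n<1+n _))
consecutive-removable _ (here refl) (there (here refl)) = _ , here
consecutive-removable (i<L ∷ y<L ∷ _) (here refl) (there (there 1+i∈)) =
  ⊥-elim (≤⇒≯ (All.lookup i<L (here refl)) (All.lookup y<L 1+i∈))
consecutive-removable (y<L ∷ _) (there i∈) (here refl) = ⊥-elim (<-asym (All.lookup y<L i∈) (n<1+n _))
consecutive-removable (_ ∷ s) (there i∈) (there 1+i∈) =
  let (_ , r) = consecutive-removable s i∈ 1+i∈ in _ , there r

vertices-∋ : ∀ {N v} → 1 ≤ v → v ≤ N → v ∈ vertices N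
vertices-∋ {N} {suc w} _ w<N =
  subst (_∈ vertices N) (cong suc (toℕ-fromℕ< w<N)) (∈-map⁺ lab (∈-allFin (Fin.fromℕ< w<N)))

vertices-sorted : ∀ N → Sorted (vertices N)
vertices-sorted N = AllPairs.map⁺ (AllPairs.tabulate⁺-< {f = λ x → x} s≤s)

length-vertices : ∀ N → length (vertices N) ≡ N
length-vertices N = trans (length-map lab (allFin N)) (length-tabulate (λ x → x))

≤∸1⇒< : ∀ {N} → 1 ≤ i → i ≤ N ∸ 1 → i < N
≤∸1⇒< {N = zero}  (s≤s _) ()
≤∸1⇒< {N = suc N} _       i≤N = s≤s i≤N

indicator-< : ∀ u v → (if u then 1 else 0) < (if v then 1 else 0) ⇔ (Bool.T (not u) × Bool.T v)
indicator-< false false = mk⇔ (λ ()) (λ ())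
indicator-< false true  = mk⇔ (λ _ → tt , tt) (λ _ → s≤s z≤n)
indicator-< true  false = mk⇔ (λ ()) (λ ())
indicator-< true  true  = mk⇔ (λ { (s≤s ()) }) (λ ())

module _ {N : ℕ} (m : Matching N) where

  chordB⇔IsChord : Bool.T (chordB m a b) ⇔ IsChord m a b
  chordB⇔IsChord {a} {b} = mk⇔ toChord fromChord
    where
    endpoints : Fin N → Bool
    endpoints j = (lab j ≡ᵇ a) ∧ (lab (partner m j) ≡ᵇ b)

    toChord : Bool.T (chordB m a b) → IsChord m a b
    toChord t with to T-∧ t
    ... | a≢b , found with Any.satisfied (any⁻ endpoints (allFin N) found)
    ...   | j , ends with to T-∧ ends
    ...     | l≡a , r≡b = j , ≡ᵇ⇒≡ _ a l≡a , ≡ᵇ⇒≡ _ b r≡b , to T-not⇔¬T a≢b ∘ ≡⇒≡ᵇ a b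

    fromChord : IsChord m a b → Bool.T (chordB m a b)
    fromChord (j , refl , refl , a≢b) =
      from T-∧ ( from T-not⇔¬T (a≢b ∘ ≡ᵇ⇒≡ a b)
               , any⁺ endpoints (Any.map (λ { refl → from T-∧ (≡⇒≡ᵇ a a refl , ≡⇒≡ᵇ b b refl) }) (∈-allFin j)))

  IsChord-sym : IsChord m a b → IsChord m b a
  IsChord-sym (j , refl , refl , a≢b) = partner m j , refl , cong lab (involutive m j) , a≢b ∘ sym

  IsChord-functional : ∀ {b'} → IsChord m a b → IsChord m a b' → b ≡ b'
  IsChord-functional (j , refl , refl , _) (k , k≡j , refl , _)
    with toℕ-injective (suc-injective k≡j)
  ... | refl = refl

  shared-endpoint⇒same-right : ∀ {a'} → a < a' → c < b → IsChord m a a' → IsChord m c b →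
                                (a ≡ c ⊎ a ≡ b) ⊎ (a' ≡ c ⊎ a' ≡ b) → a' ≡ b
  shared-endpoint⇒same-right _ _ aa' cb (inj₁ (inj₁ refl)) = IsChord-functional aa' cb
  shared-endpoint⇒same-right a<a' c<a aa' cb (inj₁ (inj₂ refl))
    with IsChord-functional aa' (IsChord-sym cb)
  ... | refl = ⊥-elim (<-asym a<a' c<a)
  shared-endpoint⇒same-right a<a' a'<b aa' cb (inj₂ (inj₁ refl))
    with IsChord-functional (IsChord-sym aa') cb
  ... | refl = ⊥-elim (<-asym a<a' a'<b)
  shared-endpoint⇒same-right _ _ _ _ (inj₂ (inj₂ a'≡b)) = a'≡b

  chordB≡true⇒IsChord : chordB m a b ≡ true → IsChord m a b
  chordB≡true⇒IsChord = to chordB⇔IsChord ∘ from T-≡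

  step-just : ∀ L {b L'} → step m L ≡ just (b , L') → ∃ λ c → IsChord m c b × PairRemoved c b L L'
  step-just (a ∷ b ∷ rest) eq with chordB m a b in isChord
  step-just (a ∷ b ∷ rest) refl | true = a , chordB≡true⇒IsChord isChord , here
  ... | false with step m (b ∷ rest) in eq'
  step-just (a ∷ b ∷ rest) refl | false | just _ =
    let (c , chord , r) = step-just (b ∷ rest) eq' in c , chord , there r

  step-nothing : ∀ L → step m L ≡ nothing → PairRemoved c b L L' → ¬ IsChord m c b
  step-nothing (a ∷ b ∷ rest) eq here chord with chordB m a b in isChord
  ... | false = subst Bool.T isChord (from chordB⇔IsChord chord)
  step-nothing (a ∷ b ∷ rest) eq (there r) with chordB m a b
  ... | false with step m (b ∷ rest) in eq'
  ...   | nothing = step-nothing (b ∷ rest) eq' r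

  reduce-⊆ : ∀ k L → x ∈ reduce m k L → x ∈ L
  reduce-⊆ (suc k) L x∈ with step m L in eq
  ... | just (_ , L') with step-just L eq | x∈
  ...   | _ , _ , r | here refl = removed-∈ʳ r
  ...   | _ , _ , r | there x∈' = removed-⊆ r (reduce-⊆ k L' x∈')

  reduce-rightEndpoint : ∀ k L → Sorted L → x ∈ reduce m k L → ∃ λ c → c < x × IsChord m c x
  reduce-rightEndpoint (suc k) L sorted x∈ with step m L in eq
  ... | just (_ , L') with step-just L eq | x∈
  ...   | c , chord , r | here refl = c , removed-< r sorted , chord
  ...   | _ , _ ,     r | there x∈' = reduce-rightEndpoint k L' (removed-sorted r sorted) x∈'

  reduce-∌-leftEndpoint : ∀ k L {y} → Sorted L → x < y → IsChord m x y → x ∉ reduce m k L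
  reduce-∌-leftEndpoint k L sorted x<y xy x∈ with reduce-rightEndpoint k L sorted x∈
  ... | c , c<x , cx with IsChord-functional (IsChord-sym cx) xy
  ... | refl = <-asym c<x x<y

  reduce-∋-short : ∀ k L → Sorted L → length L ≤ k → i ∈ L → suc i ∈ L →
                   IsChord m i (suc i) → suc i ∈ reduce m k L
  reduce-∋-short zero (_ ∷ _) _ () _ _ _
  reduce-∋-short {i} (suc k) L sorted len i∈ 1+i∈ short with step m L in eq
  ... | nothing = ⊥-elim (step-nothing L eq (proj₂ (consecutive-removable sorted i∈ 1+i∈)) short)
  ... | just (b , L') with step-just L eq
  ...   | c , chord , r with suc i ≟ b
  ...     | yes refl = here refl
  ...     | no 1+i≢b = there (reduce-∋-short k L' (removed-sorted r sorted) len' i∈' 1+i∈' short)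
    where
    deletes-short : (i ≡ c ⊎ i ≡ b) ⊎ (suc i ≡ c ⊎ suc i ≡ b) → suc i ≡ b
    deletes-short = shared-endpoint⇒same-right (n<1+n i) (removed-< r sorted) short chord

    len' : length L' ≤ k
    len' = ≤-pred (≤-trans (n≤1+n _) (subst (_≤ suc k) (removed-length r) len))

    i∈' : i ∈ L'
    i∈' = removed-keeps r i∈ (1+i≢b ∘ deletes-short ∘ inj₁)

    1+i∈' : suc i ∈ L'
    1+i∈' = removed-keeps r 1+i∈ (1+i≢b ∘ deletes-short ∘ inj₂)

  reduce-short : ∀ k L → Sorted L → i ∈ L → suc i ∈ reduce m k L → i ∉ reduce m k L →
                 IsChord m i (suc i)
  reduce-short {i} (suc k) L sorted i∈ 1+i∈U i∉U with step m L in eq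
  ... | just (b , L') with step-just L eq
  ...   | c , chord , r with suc i ≟ b | 1+i∈U
  ...     | yes refl | _ = subst (λ z → IsChord m z (suc i)) c≡i chord
    where
    c≡i : c ≡ i
    c≡i with removed-gap r sorted i∈
    ... | inj₁ i≤c   = ≤-antisym (≤-pred (removed-< r sorted)) i≤c
    ... | inj₂ 1+i≤i = ⊥-elim (1+n≰n 1+i≤i)
  ...     | no 1+i≢b | here 1+i≡b = ⊥-elim (1+i≢b 1+i≡b)
  ...     | no 1+i≢b | there 1+i∈U' with removed-split r i∈
  ...       | inj₂ (inj₁ i≡b) = ⊥-elim (i∉U (here i≡b))
  ...       | inj₂ (inj₂ i∈') =
    reduce-short k L' (removed-sorted r sorted) i∈' 1+i∈U' (i∉U ∘ there)
  ...       | inj₁ refl with removed-gap r sorted (removed-⊆ r (reduce-⊆ k L' 1+i∈U'))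
  ...         | inj₁ 1+i≤i = ⊥-elim (1+n≰n 1+i≤i)
  ...         | inj₂ b≤1+i = ⊥-elim (1+i≢b (≤-antisym (removed-< r sorted) b≤1+i))

  reduce-descent⇔short : ∀ k L → Sorted L → length L ≤ k → i ∈ L → suc i ∈ L →
                         (i ∉ reduce m k L × suc i ∈ reduce m k L) ⇔ IsChord m i (suc i)
  reduce-descent⇔short {i} k L sorted len i∈ 1+i∈ = mk⇔
    (λ (i∉U , 1+i∈U) → reduce-short k L sorted i∈ 1+i∈U i∉U)
    (λ short → reduce-∌-leftEndpoint k L sorted (n<1+n i) short
             , reduce-∋-short k L sorted len i∈ 1+i∈ short)

  rowOf-T : ∀ {v} → v ∈ vertices N → rowOf (T m) v ≡ just (if memB v (unstableTops m) then 1 else 0)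
  rowOf-T {v} v∈
    rewrite memB-filter (λ w → not (memB w (unstableTops m))) v∈
          | memB-filter (λ w → memB w (unstableTops m)) v∈
    with memB v (unstableTops m)
  ... | true  = refl
  ... | false = refl

  SuccInLowerRow : ℕ → Set
  SuccInLowerRow i =
    Σ ℕ λ r → Σ ℕ λ s → rowOf (T m) i ≡ just r × rowOf (T m) (suc i) ≡ just s × r < s

  succInLowerRow⇔ : i ∈ vertices N → suc i ∈ vertices N →
                    SuccInLowerRow i ⇔ (i ∉ unstableTops m × suc i ∈ unstableTops m)
  succInLowerRow⇔ {i} i∈ 1+i∈ = mk⇔
    (λ (r , s , row-i , row-1+i , r<s) →
       unstable (to (indicator-< _ _)
         (subst₂ _<_ (just-injective (trans (sym row-i) (rowOf-T i∈)))
                     (just-injective (trans (sym row-1+i) (rowOf-T 1+i∈))) r<s)))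
    (λ (i∉U , 1+i∈U) →
       _ , _ , rowOf-T i∈ , rowOf-T 1+i∈ ,
       from (indicator-< _ _) (from T-not⇔¬T (i∉U ∘ to memB⇔∈) , from memB⇔∈ 1+i∈U))
    where
    unstable : Bool.T (not (memB i (unstableTops m))) × Bool.T (memB (suc i) (unstableTops m)) →
               i ∉ unstableTops m × suc i ∈ unstableTops m
    unstable (i∉ , 1+i∈U) = to T-not⇔¬T i∉ ∘ from memB⇔∈ , to memB⇔∈ 1+i∈U

proposition4p7 : (N f : ℕ) (m : Matching N) → InM N f m →
    (i : ℕ) → (InDes N (T m) i ⇔ InShort m i)
proposition4p7 N f m _ i = mk⇔
  (λ (lo , hi , lower) → lo , hi , to (lowerRow⇔short lo hi) lower)
  (λ (lo , hi , short) → lo , hi , from (lowerRow⇔short lo hi) short)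
  where
  lowerRow⇔short : 1 ≤ i → i ≤ N ∸ 1 → SuccInLowerRow m i ⇔ IsChord m i (suc i)
  lowerRow⇔short lo hi =
    ⇔-trans (succInLowerRow⇔ m i∈ 1+i∈)
            (reduce-descent⇔short m N (vertices N) (vertices-sorted N)
               (≤-reflexive (length-vertices N)) i∈ 1+i∈)
    where
    i∈ : i ∈ vertices N
    i∈ = vertices-∋ lo (<⇒≤ (≤∸1⇒< lo hi))

    1+i∈ : suc i ∈ vertices N
    1+i∈ = vertices-∋ (s≤s z≤n) (≤∸1⇒< lo hi)
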